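{- If $G$ is a connected graph with $c(G) = \theta(G) = k\geq 3$, then $G$ contains a triangle.
   Context: All graphs are finite and simple. $\theta(G)$ is the clique cover number: the least number of cliques whose vertex sets partition $V(G)$. The Cops and Robbers game on $G$: first $m$ cops are placed on vertices, then the robber is placed; players alternate turns starting with the cops; on a turn each cop (resp. the robber) moves to an adjacent vertex or stays. The cops win if after finitely many moves a cop occupies the robber's vertex. The cop number $c(G)$ is the least $m$ such that $m$ cops can always win. -}

module Defs where

open import Data.Nat using (ℕ; _<_)
open import Data.Fin using (Fin)
open import Data.Product using (Σ; ∃; _×_; _,_)
open import Data.Sum using (_⊎_)
open import Relation.Nullary using (¬_; Dec)
open import Relation.Binary.PropositionalEquality using (_≡_; _≢_)
open import Relation.Binary.Construct.Closure.ReflexiveTransitive using (Star)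

record Graph : Set₁ where
  field
    n     : ℕ
    Adj   : Fin n → Fin n → Set
    sym   : ∀ {u v} → Adj u v → Adj v u
    irr   : ∀ {u} → ¬ Adj u u
    dec   : ∀ u v → Dec (Adj u v)

module _ (G : Graph) where
  open Graph G

  Vertex : Set
  Vertex = Fin n

  Connected : Set
  Connected = ∀ (u v : Vertex) → Star Adj u v

  -- G contains a triangle (K₃ as a subgraph; distinctness follows from irr)
  HasTriangle : Set
  HasTriangle = Σ Vertex λ u → Σ Vertex λ v → Σ Vertex λ w →
                Adj u v × Adj v w × Adj u w

  -- a partition of V(G) into k cliques, given by a labelling of vertices with
  -- k labels whose classes are cliques (empty classes are harmless for the
  -- minimum below)
  CliqueCover : ℕ → Set
  CliqueCover k = Σ (Vertex → Fin k) λ f →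
                  ∀ u v → f u ≡ f v → u ≢ v → Adj u v

  CliqueCoverNumber≡ : ℕ → Set
  CliqueCoverNumber≡ k = CliqueCover k × (∀ m → m < k → ¬ CliqueCover m)

  Step : Vertex → Vertex → Set
  Step x y = x ≡ y ⊎ Adj x y

  Caught : ∀ {m} → (Fin m → Vertex) → Vertex → Set
  Caught {m} cs r = ∃ λ (i : Fin m) → cs i ≡ r

  -- CopsWin cs r : position with cops at cs, robber at r, cops to move;
  -- the cops can force capture after finitely many moves (inductive
  -- definition = least fixed point, i.e. the cops' attractor).
  data CopsWin {m : ℕ} (cs : Fin m → Vertex) (r : Vertex) : Set where
    move : (cs' : Fin m → Vertex) →
           (∀ i → Step (cs i) (cs' i)) →
           (Caught cs' r ⊎
             (∀ r' → Step r r' → Caught cs' r' ⊎ CopsWin cs' r')) →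
           CopsWin cs r

  -- m cops win on G: cops are placed first, then the robber, then the cops
  -- move first.
  CopsWinGame : ℕ → Set
  CopsWinGame m = Σ (Fin m → Vertex) λ cs →
                  ∀ r → Caught cs r ⊎ CopsWin cs r

  CopNumber≡ : ℕ → Set
  CopNumber≡ k = CopsWinGame k × (∀ m → m < k → ¬ CopsWinGame m)

{-# OPTIONS --safe #-}
module Submission where

-- In a triangle-free graph every clique of a cover has at most two vertices.
-- For a minimal cover by k ≥ 3 cliques we show that k − 1 cops win. One cop per
-- class dominates the graph, so one cop must be saved. Take an edge uw from
-- class p to class l. Either every vertex of class l is in the closed
-- neighbourhood of class p, or the other vertex w' of class l has no neighbour in
-- class p: then class l gets no cop, the class-p cop sits on u, and if the robber
-- sits on w' that cop steps to w, after which every move of the robber lands in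
-- a dominated vertex. Applied to an edge xy between classes i and j and to an
-- edge leaving the union of both classes (connectivity), this yields a third
-- class l such that classes j and l are dominated by class i (or classes i and l
-- by class j); two cops on the at most two vertices of that class then do the
-- work of the three cops of classes i, j and l.

open import Defs
open import Data.Nat using (ℕ; suc; _+_; _≤_; s≤s; z≤n)
open import Data.Nat.Properties using (n<1+n)
open import Data.Fin using (Fin; zero; suc; punchIn; punchOut; _≟_)
open import Data.Fin.Properties using (any?; punchIn-punchOut)
open import Data.Vec.Functional using (updateAt)
open import Data.Vec.Functional.Properties using (updateAt-updates; updateAt-minimal)
open import Data.Product using (Σ; ∃; ∃₂; _×_; _,_; proj₁; proj₂)
open import Data.Sum using (_⊎_; inj₁; inj₂; [_,_]; map; map₂)
open import Data.Empty using (⊥-elim)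
open import Function using (_∘_; const)
open import Relation.Nullary using (¬_; Dec; yes; no)
open import Relation.Nullary.Decidable using (_×-dec_; _⊎-dec_; ¬?; decidable-stable)
open import Relation.Binary.PropositionalEquality using (_≡_; _≢_; refl; sym; trans; subst)
open import Relation.Binary.Construct.Closure.ReflexiveTransitive using (Star; ε; _◅_)

module _ {a ℓ p} {A : Set a} {R : A → A → Set ℓ}
         (P : A → Set p) (P? : ∀ x → Dec (P x)) where

  boundary-edge : ∀ {x y} → Star R x y → P x → ¬ P y →
                  ∃₂ λ u w → R u w × P u × ¬ P w
  boundary-edge ε px ¬py = ⊥-elim (¬py px)
  boundary-edge {x} (_◅_ {j = z} xz zy) px ¬py with P? z
  ... | yes pz = boundary-edge zy pz ¬py
  ... | no ¬pz = x , z , xz , px , ¬pz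

third-label : ∀ {m} (i j : Fin (3 + m)) → ∃ λ l → l ≢ i × l ≢ j
third-label zero          zero          = suc zero , (λ ()) , (λ ())
third-label zero          (suc zero)    = suc (suc zero) , (λ ()) , (λ ())
third-label zero          (suc (suc j)) = suc zero , (λ ()) , (λ ())
third-label (suc zero)    zero          = suc (suc zero) , (λ ()) , (λ ())
third-label (suc (suc i)) zero          = suc zero , (λ ()) , (λ ())
third-label (suc i)       (suc j)       = zero , (λ ()) , (λ ())

module _ (G : Graph) where
  open Graph G using (Adj; dec)

  triangle? : Dec (HasTriangle G)
  triangle? = any? λ u → any? λ v → any? λ w → dec u v ×-dec dec v w ×-dec dec u w

  step-sym : ∀ {u v} → Step G u v → Step G v u
  step-sym (inj₁ u≡v) = inj₁ (sym u≡v)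
  step-sym (inj₂ uv)  = inj₂ (Graph.sym G uv)

  step? : ∀ u v → Dec (Step G u v)
  step? u v = (u ≟ v) ⊎-dec dec u v

  Dominated : ∀ {m} → (Fin m → Vertex G) → Vertex G → Set
  Dominated cs r = ∃ λ i → Step G (cs i) r

  step-updateAt : ∀ {m} (cs : Fin m → Vertex G) i {v} → Step G (cs i) v →
                  ∀ j → Step G (cs j) (updateAt cs i (const v) j)
  step-updateAt cs i s j with j ≟ i
  ... | yes refl = subst (Step G (cs i)) (sym (updateAt-updates i cs)) s
  ... | no j≢i   = inj₁ (sym (updateAt-minimal j i cs j≢i))

  capture : ∀ {m} {cs : Fin m → Vertex G} {r} → Dominated cs r → CopsWin G cs r
  capture {cs = cs} {r} (i , s) =
    move (updateAt cs i (const r)) (step-updateAt cs i s) (inj₁ (i , updateAt-updates i cs))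

  win-in-two-moves : ∀ {m} (cs cs' : Fin m → Vertex G) → (∀ i → Step G (cs i) (cs' i)) →
                     (∀ r → Dominated cs r ⊎ (∀ r' → Step G r r' → Dominated cs' r')) →
                     CopsWinGame G m
  win-in-two-moves cs cs' steps dominated = cs , λ r → inj₂ (strategy r (dominated r))
    where
    strategy : ∀ r → Dominated cs r ⊎ (∀ r' → Step G r r' → Dominated cs' r') → CopsWin G cs r
    strategy r (inj₁ d)    = capture d
    strategy r (inj₂ next) = move cs' steps (inj₂ λ r' s → inj₂ (capture (next r' s)))

  win-by-domination : ∀ {m} (cs : Fin m → Vertex G) → (∀ r → Dominated cs r) → CopsWinGame G m
  win-by-domination cs dominated = win-in-two-moves cs cs (λ _ → inj₁ refl) (inj₁ ∘ dominated)

  inter-class-edge : ∀ {k} → Connected G → (f : Vertex G → Fin k) →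
                     (∀ u v → f u ≡ f v → u ≢ v → Adj u v) → ¬ CliqueCover G 1 →
                     ∃₂ λ x y → Adj x y × f x ≢ f y
  inter-class-edge conn f clique not-clique with any? (λ u → any? λ v → ¬? (f u ≟ f v))
  ... | no none = ⊥-elim (not-clique ((λ _ → zero) , λ u v _ → clique u v (same-class u v)))
    where
    same-class : ∀ u v → f u ≡ f v
    same-class u v = decidable-stable (f u ≟ f v) λ fu≢fv → none (u , v , fu≢fv)
  ... | yes (u , v , fu≢fv)
    with boundary-edge (λ w → f w ≡ f u) (λ w → f w ≟ f u) (conn u v) refl (fu≢fv ∘ sym)
  ...   | x , y , xy , fx≡fu , fy≢fu = x , y , xy , λ fx≡fy → fy≢fu (trans (sym fx≡fy) fx≡fu)

module CliqueCoverStrategies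
    (G : Graph) (m : ℕ) (f : Vertex G → Fin (suc m))
    (clique : ∀ u v → f u ≡ f v → u ≢ v → Graph.Adj G u v)
    (triangle-free : ¬ HasTriangle G) where
  open Graph G using (Adj) renaming (sym to Adj-sym)

  Label : Set
  Label = Fin (suc m)

  step-in-class : ∀ {u v} → f u ≡ f v → Step G u v
  step-in-class {u} {v} fu≡fv with u ≟ v
  ... | yes u≡v = inj₁ u≡v
  ... | no u≢v  = inj₂ (clique u v fu≡fv u≢v)

  class-⊆-pair : ∀ {u v w} → u ≢ v → f u ≡ f w → f v ≡ f w → w ≡ u ⊎ w ≡ v
  class-⊆-pair {u} {v} {w} u≢v fu≡fw fv≡fw with w ≟ u | w ≟ v
  ... | yes w≡u | _       = inj₁ w≡u
  ... | no _    | yes w≡v = inj₂ w≡v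
  ... | no w≢u  | no w≢v  = ⊥-elim (triangle-free
        (u , v , w , clique u v (trans fu≡fw (sym fv≡fw)) u≢v ,
         clique v w fv≡fw (w≢v ∘ sym) , clique u w fu≡fw (w≢u ∘ sym)))

  class-partner : ∀ x → ∃ λ x' → ∀ r → f r ≡ f x → r ≡ x ⊎ r ≡ x'
  class-partner x with any? (λ v → (f v ≟ f x) ×-dec ¬? (v ≟ x))
  ... | yes (x' , fx'≡fx , x'≢x) = x' , λ r fr≡fx →
    class-⊆-pair (x'≢x ∘ sym) (sym fr≡fx) (trans fx'≡fx (sym fr≡fx))
  ... | no none = x , λ r fr≡fx →
    inj₁ (decidable-stable (r ≟ x) λ r≢x → none (r , fr≡fx , r≢x))

  Guards : Vertex G → Label → Set
  Guards g c = ∀ r → f r ≡ c → Step G g r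

  Guarding : (Label → Vertex G) → Set
  Guarding P = ∀ c → Guards (P c) c

  guard : Vertex G → (c : Label) → Σ (Vertex G) λ g → Guards g c
  guard v c with any? (λ u → f u ≟ c)
  ... | yes (u , fu≡c) = u , λ r fr≡c → step-in-class (trans fu≡c (sym fr≡c))
  ... | no empty       = v , λ r fr≡c → ⊥-elim (empty (r , fr≡c))

  guards : Vertex G → Label → Vertex G
  guards v = proj₁ ∘ guard v

  guards-guarding : ∀ v → Guarding (guards v)
  guards-guarding v = proj₂ ∘ guard v

  updateAt-guarding : ∀ {P c g} → Guarding P → f g ≡ c → Guarding (updateAt P c (const g))
  updateAt-guarding {P} {c} {g} guarding fg≡c d r fr≡d with d ≟ c
  ... | yes refl = subst (λ h → Step G h r) (sym (updateAt-updates d P))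
                         (step-in-class (trans fg≡c (sym fr≡d)))
  ... | no d≢c   =
    subst (λ h → Step G h r) (sym (updateAt-minimal d c P d≢c)) (guarding d r fr≡d)

  -- P places a cop for each label; dropping the cop of label q leaves the m cops P ∘ punchIn q.
  DominatedAvoiding : (Label → Vertex G) → Label → Vertex G → Set
  DominatedAvoiding P q r = ∃ λ c → c ≢ q × Step G (P c) r

  avoiding : ∀ {P q c g r} → P c ≡ g → c ≢ q → Step G g r → DominatedAvoiding P q r
  avoiding {P} {r = r} Pc≡g c≢q s = _ , c≢q , subst (λ h → Step G h r) (sym Pc≡g) s

  dominated-punchIn : ∀ {P q r} → DominatedAvoiding P q r → Dominated G (P ∘ punchIn q) r
  dominated-punchIn {P} {r = r} (c , c≢q , s) =
    punchOut (c≢q ∘ sym) , subst (λ d → Step G (P d) r) (sym (punchIn-punchOut (c≢q ∘ sym))) s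

  guarding-dominates : ∀ {P q r} → Guarding P → f r ≢ q → DominatedAvoiding P q r
  guarding-dominates {r = r} guarding fr≢q = avoiding refl fr≢q (guarding (f r) r refl)

  win-by-pair : ∀ {p q l a a'} → p ≢ q → l ≢ q → p ≢ l → f a ≡ p →
                (∀ r → f r ≡ q → Step G a r ⊎ Step G a' r) →
                (∀ r → f r ≡ l → Step G a r ⊎ Step G a' r) → CopsWinGame G m
  win-by-pair {p} {q} {l} {a} {a'} p≢q l≢q p≢l fa≡p near-q near-l =
    win-by-domination G (P ∘ punchIn q) (dominated-punchIn ∘ dominated)
    where
    P₀ P : Label → Vertex G
    P₀ = updateAt (guards a) p (const a)
    P  = updateAt P₀ l (const a')

    near-pair : ∀ {r} → Step G a r ⊎ Step G a' r → DominatedAvoiding P q r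
    near-pair (inj₁ s) =
      avoiding (trans (updateAt-minimal p l P₀ p≢l) (updateAt-updates p (guards a))) p≢q s
    near-pair (inj₂ s) = avoiding (updateAt-updates l P₀) l≢q s

    dominated : ∀ r → DominatedAvoiding P q r
    dominated r with f r ≟ q | f r ≟ l
    ... | yes fr≡q | _        = near-pair (near-q r fr≡q)
    ... | no _     | yes fr≡l = near-pair (near-l r fr≡l)
    ... | no fr≢q  | no fr≢l  = avoiding (updateAt-minimal (f r) l P₀ fr≢l) fr≢q
        (updateAt-guarding (guards-guarding a) fa≡p (f r) r refl)

  win-by-chasing : ∀ {i j x y y'} → i ≢ j → f x ≡ i → f y ≡ j → Adj x y →
                   (∀ r → f r ≡ j → r ≡ y ⊎ r ≡ y') → (∀ r → Step G y' r → f r ≢ i) →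
                   CopsWinGame G m
  win-by-chasing {i} {j} {x} {y} {y'} i≢j fx≡i fy≡j xy class-j y'-far =
    win-in-two-moves G (P ∘ punchIn j) (P' ∘ punchIn j) (step-updateAt G P i x→y ∘ punchIn j)
      λ r → map dominated-punchIn (λ next r' → dominated-punchIn ∘ next r') (dominated r)
    where
    P P' : Label → Vertex G
    P  = updateAt (guards x) i (const x)
    P' = updateAt P i (const y)

    P-guarding : Guarding P
    P-guarding = updateAt-guarding (guards-guarding x) fx≡i

    x→y : Step G (P i) y
    x→y = subst (λ h → Step G h y) (sym (updateAt-updates i (guards x))) (inj₂ xy)

    dominated' : ∀ r' → f r' ≢ i → DominatedAvoiding P' j r'
    dominated' r' fr'≢i with f r' ≟ j
    ... | yes fr'≡j =
      avoiding (updateAt-updates i P) i≢j (step-in-class (trans fy≡j (sym fr'≡j)))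
    ... | no fr'≢j  =
      avoiding (updateAt-minimal (f r') i P fr'≢i) fr'≢j (P-guarding (f r') r' refl)

    dominated : ∀ r → DominatedAvoiding P j r ⊎
                      (∀ r' → Step G r r' → DominatedAvoiding P' j r')
    dominated r with f r ≟ j
    ... | no fr≢j = inj₁ (guarding-dominates P-guarding fr≢j)
    ... | yes fr≡j with class-j r fr≡j
    ...   | inj₁ refl = inj₁ (avoiding (updateAt-updates i (guards x)) i≢j (inj₂ xy))
    ...   | inj₂ refl = inj₂ λ r' s → dominated' r' (y'-far r' s)

  NearClass : Label → Vertex G → Set
  NearClass p r = ∃ λ v → f v ≡ p × Step G v r

  near-class? : ∀ p r → Dec (NearClass p r)
  near-class? p r = any? λ v → (f v ≟ p) ×-dec step? G v r

  class-near-or-win : ∀ {p l u w} → p ≢ l → f u ≡ p → f w ≡ l → Adj u w →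
                      CopsWinGame G m ⊎ (∀ r → f r ≡ l → NearClass p r)
  class-near-or-win {p} {l} {u} {w} p≢l fu≡p fw≡l uw
    with any? (λ r → (f r ≟ l) ×-dec ¬? (near-class? p r))
  ... | no none =
    inj₂ λ r fr≡l → decidable-stable (near-class? p r) λ far → none (r , fr≡l , far)
  ... | yes (w' , fw'≡l , w'-far) =
    inj₁ (win-by-chasing p≢l fu≡p fw≡l uw class-l λ r s fr≡p → w'-far (r , fr≡p , step-sym G s))
    where
    w≢w' : w ≢ w'
    w≢w' refl = w'-far (u , fu≡p , inj₂ uw)

    class-l : ∀ r → f r ≡ l → r ≡ w ⊎ r ≡ w'
    class-l r fr≡l = class-⊆-pair w≢w' (trans fw≡l (sym fr≡l)) (trans fw'≡l (sym fr≡l))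

  win-by-class-pair : ∀ {q l} x → f x ≢ q → l ≢ q → f x ≢ l →
                      (∀ r → f r ≡ q → NearClass (f x) r) →
                      (∀ r → f r ≡ l → NearClass (f x) r) → CopsWinGame G m
  win-by-class-pair x fx≢q l≢q fx≢l near-q near-l with class-partner x
  ... | x' , class-x =
    win-by-pair fx≢q l≢q fx≢l refl (λ r → near-pair ∘ near-q r) (λ r → near-pair ∘ near-l r)
    where
    near-pair : ∀ {r} → NearClass (f x) r → Step G x r ⊎ Step G x' r
    near-pair (v , fv≡fx , s) with class-x v fv≡fx
    ... | inj₁ refl = inj₁ s
    ... | inj₂ refl = inj₂ s

  third-class-near-or-win :
    Connected G → (∀ i j → ∃ λ l → l ≢ i × l ≢ j) → ∀ x j →
    CopsWinGame G m ⊎ ∃ λ l → l ≢ f x × l ≢ j ×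
      ((∀ r → f r ≡ l → NearClass (f x) r) ⊎ (∀ r → f r ≡ l → NearClass j r))
  third-class-near-or-win conn third x j with any? (λ w → ¬? (f w ≟ f x) ×-dec ¬? (f w ≟ j))
  ... | no none =
    let (l , l≢i , l≢j) = third (f x) j in
    inj₂ (l , l≢i , l≢j , inj₁ λ r fr≡l →
      ⊥-elim (none (r , l≢i ∘ trans (sym fr≡l) , l≢j ∘ trans (sym fr≡l))))
  ... | yes (w , fw≢i , fw≢j)
    with boundary-edge (λ v → f v ≡ f x ⊎ f v ≡ j) (λ v → (f v ≟ f x) ⊎-dec (f v ≟ j))
                       (conn x w) (inj₁ refl) [ fw≢i , fw≢j ]
  ...   | u , v , uv , u∈i∪j , v∉i∪j =
    map₂ (λ near → f v , v∉i∪j ∘ inj₁ , v∉i∪j ∘ inj₂ , near) (near-or-win u∈i∪j)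
    where
    near-or-win : f u ≡ f x ⊎ f u ≡ j →
                  CopsWinGame G m ⊎ ((∀ r → f r ≡ f v → NearClass (f x) r) ⊎
                                     (∀ r → f r ≡ f v → NearClass j r))
    near-or-win (inj₁ fu≡i) =
      map₂ inj₁ (class-near-or-win (v∉i∪j ∘ inj₁ ∘ sym) fu≡i refl uv)
    near-or-win (inj₂ fu≡j) =
      map₂ inj₂ (class-near-or-win (v∉i∪j ∘ inj₂ ∘ sym) fu≡j refl uv)

  win-from-inter-class-edge : Connected G → (∀ i j → ∃ λ l → l ≢ i × l ≢ j) →
                              ∀ {x y} → Adj x y → f x ≢ f y → CopsWinGame G m
  win-from-inter-class-edge conn third {x} {y} xy fx≢fy
    with class-near-or-win fx≢fy refl refl xy
       | class-near-or-win (fx≢fy ∘ sym) refl refl (Adj-sym xy)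
       | third-class-near-or-win conn third x (f y)
  ... | inj₁ win | _        | _        = win
  ... | inj₂ _   | inj₁ win | _        = win
  ... | inj₂ _   | inj₂ _   | inj₁ win = win
  ... | inj₂ y-near-x | inj₂ _ | inj₂ (l , l≢fx , l≢fy , inj₁ l-near-x) =
    win-by-class-pair x fx≢fy l≢fy (l≢fx ∘ sym) y-near-x l-near-x
  ... | inj₂ _ | inj₂ x-near-y | inj₂ (l , l≢fx , l≢fy , inj₂ l-near-y) =
    win-by-class-pair y (fx≢fy ∘ sym) l≢fx (l≢fy ∘ sym) x-near-y l-near-y

lemma3p3 : (G : Graph) (k : ℕ) → Connected G → 3 ≤ k →
           CopNumber≡ G k → CliqueCoverNumber≡ G k → HasTriangle G
lemma3p3 G (suc (suc (suc m))) conn (s≤s (s≤s (s≤s z≤n)))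
         (_ , fewer-cops-lose) ((f , clique) , fewer-cliques-fail) with triangle? G
... | yes triangle     = triangle
... | no triangle-free =
  let (x , y , xy , fx≢fy) =
        inter-class-edge G conn f clique (fewer-cliques-fail 1 (s≤s (s≤s z≤n)))
  in ⊥-elim (fewer-cops-lose (2 + m) (n<1+n _)
       (win-from-inter-class-edge conn third-label xy fx≢fy))
  where open CliqueCoverStrategies G (2 + m) f clique triangle-free
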